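{- Let $p$ be a large integer and consider vertex set $A\uplus B$ with $A=\{a_1,\dots,a_{p+1}\}$, $B=\{b_1,\dots,b_p\}$. Let $H$ be the graph consisting of a clique on $A$ and a clique on $B$ with no edges between $A$ and $B$, and for $1\le i<j\le p$ let $H_{ij}$ be the graph on the same vertex set with \[E(H_{ij})=\big(E(H)\setminus\{\{a_i,a_j\},\{b_i,b_j\}\}\big)\cup\{\{a_i,b_j\},\{a_j,b_i\}\}.\] Then for all $1\le i<j\le p$, $\kappa(H_{ij})=p-1$, whereas the chromatic number $\chi(H)=p+1$.
   Context: $\kappa(\cdot)$ denotes degeneracy: the least $k$ such that every induced subgraph has a vertex of degree at most $k$. -}

module Defs where

open import Data.Bool using (Bool; true; false; _∧_; _∨_; not; if_then_else_)
open import Data.Nat using (ℕ; zero; suc; _+_; _≤_)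
open import Data.Fin using (Fin; splitAt; _↑ˡ_; _↑ʳ_; _≟_)
open import Data.List using (List; map; allFin)
open import Data.Nat.ListAction using (sum)
open import Data.Sum using (_⊎_; inj₁; inj₂)
open import Data.Product using (Σ; ∃; _×_; _,_)
open import Relation.Nullary.Decidable using (⌊_⌋)
open import Relation.Binary.PropositionalEquality using (_≡_; _≢_)

-- A graph on vertex set Fin n, given by its Boolean adjacency function.
-- (The concrete graphs H, H_ij below are symmetric and irreflexive by
-- construction, i.e. finite simple graphs.)
Graph : ℕ → Set
Graph n = Fin n → Fin n → Bool

VSet : ℕ → Set
VSet n = Fin n → Bool

Nonempty : ∀ {n} → VSet n → Set
Nonempty {n} S = Σ (Fin n) λ v → S v ≡ true

degIn : ∀ {n} → Graph n → VSet n → Fin n → ℕ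
degIn {n} G S v = sum (map (λ u → if S u ∧ G v u then 1 else 0) (allFin n))

Degenerate : ∀ {n} → ℕ → Graph n → Set
Degenerate {n} k G =
  (S : VSet n) → Nonempty S → Σ (Fin n) λ v → (S v ≡ true) × (degIn G S v ≤ k)

IsDegeneracy : ∀ {n} → Graph n → ℕ → Set
IsDegeneracy G k = Degenerate k G × (∀ k′ → Degenerate k′ G → k ≤ k′)

Colourable : ∀ {n} → ℕ → Graph n → Set
Colourable {n} k G =
  Σ (Fin n → Fin k) λ c → ∀ u v → G u v ≡ true → c u ≢ c v

IsChromaticNumber : ∀ {n} → Graph n → ℕ → Set
IsChromaticNumber G k = Colourable k G × (∀ k′ → Colourable k′ G → k ≤ k′)

-- The construction.  Vertex set A ⊎ B encoded as Fin (suc p + p):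
-- a i = i ↑ˡ p  (i : Fin (suc p)),  b j = suc p ↑ʳ j  (j : Fin p).

V : ℕ → ℕ
V p = suc p + p

a : ∀ p → Fin (suc p) → Fin (V p)
a p i = i ↑ˡ p

b : ∀ p → Fin p → Fin (V p)
b p j = suc p ↑ʳ j

_==_ : ∀ {n} → Fin n → Fin n → Bool
x == y = ⌊ x ≟ y ⌋

Hadj : ∀ p → Fin (V p) → Fin (V p) → Bool
Hadj p x y with splitAt (suc p) x | splitAt (suc p) y
... | inj₁ i | inj₁ j = not (i == j)
... | inj₂ i | inj₂ j = not (i == j)
... | inj₁ _ | inj₂ _ = false
... | inj₂ _ | inj₁ _ = false

isPair : ∀ {n} → Fin n → Fin n → Fin n → Fin n → Bool
isPair u w x y = (x == u ∧ y == w) ∨ (x == w ∧ y == u)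

-- adjacency of H_ij (i, j : Fin p are the 0-indexed versions of 1 ≤ i < j ≤ p;
-- a_i for i ≤ p is  a p (inject₁ i))
open import Data.Fin using (inject₁)

Hijadj : ∀ p → Fin p → Fin p → Fin (V p) → Fin (V p) → Bool
Hijadj p i j x y =
  (Hadj p x y ∧ not (isPair (a p (inject₁ i)) (a p (inject₁ j)) x y
                     ∨ isPair (b p i) (b p j) x y))
  ∨ isPair (a p (inject₁ i)) (b p j) x y
  ∨ isPair (a p (inject₁ j)) (b p i) x y

H : ∀ p → Graph (V p)
H = Hadj

Hij : ∀ p → Fin p → Fin p → Graph (V p)
Hij = Hijadj

-- Every b_k has at
-- most p − 1 neighbours at all; an induced subgraph inside A has a vertex
-- missing two of the p + 1 vertices of A (a_i misses a_j, or any vertex misses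
-- an absent a_i).  Conversely, in A ∖ {a_i} (p vertices, all pairwise
-- adjacent) every vertex has degree p − 1.

module Submission where

open import Defs
open import Data.Nat using (ℕ; suc; _∸_)
open import Data.Fin using (Fin; _<_)
open import Data.Product using (_×_)

open import Data.Bool as Bool using (Bool; true; false; _∧_; _∨_; not; if_then_else_)
open import Data.Bool.Properties using (∨-zeroʳ; ∧-conicalˡ; ∧-conicalʳ; ¬-not)
open import Data.Nat as ℕ using (zero; _+_; _≤_; z≤n)
open import Data.Nat.Properties as ℕ using (+-mono-≤; +-comm; +-identityʳ; +-commutativeSemigroup)
open import Algebra.Properties.CommutativeSemigroup +-commutativeSemigroup using (interchange)
open import Data.Fin as Fin using (zero; suc; _↑ˡ_; _↑ʳ_; _≟_; splitAt)
import Data.Fin.Properties as Fin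
open import Data.List using (map; allFin)
import Data.List.Properties as List
open import Data.Nat.ListAction using (sum)
open import Data.Sum using (_⊎_; inj₁; inj₂)
open import Data.Product using (Σ; _,_; proj₁; proj₂)
open import Data.Empty using (⊥; ⊥-elim)
open import Relation.Nullary using (¬_; contradiction)
open import Relation.Nullary.Decidable using (yes; no)
open import Relation.Binary.PropositionalEquality
open import Function using (case_of_)

ind : Bool → ℕ
ind b = if b then 1 else 0

count : ∀ {n} → (Fin n → Bool) → ℕ
count {n} P = sum (map (λ u → ind (P u)) (allFin n))

count-suc : ∀ {n} (P : Fin (suc n) → Bool) → count P ≡ ind (P zero) + count (λ u → P (suc u))
count-suc P = cong (λ xs → ind (P zero) + sum xs)
  (trans (List.map-tabulate suc (λ u → ind (P u)))
         (sym (List.map-tabulate (λ u → u) (λ u → ind (P (suc u))))))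

count-cong : ∀ {n} {P Q : Fin n → Bool} → (∀ u → P u ≡ Q u) → count P ≡ count Q
count-cong {n} P≗Q = cong sum (List.map-cong (λ u → cong ind (P≗Q u)) (allFin n))

count-split : ∀ m {n} (P : Fin (m + n) → Bool) →
  count P ≡ count (λ l → P (l ↑ˡ n)) + count (λ r → P (m ↑ʳ r))
count-split zero P = refl
count-split (suc m) {n} P = begin
    count P
  ≡⟨ count-suc P ⟩
    ind (P zero) + count (λ u → P (suc u))
  ≡⟨ cong (ind (P zero) +_) (count-split m (λ u → P (suc u))) ⟩
    ind (P zero) + (count (λ l → P (suc (l ↑ˡ n))) + count (λ r → P (suc m ↑ʳ r)))
  ≡⟨ sym (ℕ.+-assoc (ind (P zero)) _ _) ⟩
    (ind (P zero) + count (λ l → P (suc (l ↑ˡ n)))) + count (λ r → P (suc m ↑ʳ r))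
  ≡⟨ cong (_+ count (λ r → P (suc m ↑ʳ r))) (sym (count-suc (λ l → P (l ↑ˡ n)))) ⟩
    count (λ l → P (l ↑ˡ n)) + count (λ r → P (suc m ↑ʳ r))
  ∎ where open ≡-Reasoning

count-mono : ∀ {n} {P Q : Fin n → Bool} → (∀ u → P u ≡ true → Q u ≡ true) → count P ≤ count Q
count-mono {zero} P⊆Q = z≤n
count-mono {suc n} {P} {Q} P⊆Q rewrite count-suc P | count-suc Q =
  +-mono-≤ (ind-mono (P⊆Q zero)) (count-mono (λ u → P⊆Q (suc u)))
  where
    ind-mono : ∀ {x y} → (x ≡ true → y ≡ true) → ind x ≤ ind y
    ind-mono {false} _ = z≤n
    ind-mono {true} x⇒y rewrite x⇒y refl = ℕ.≤-refl

count-none : ∀ {n} {P : Fin n → Bool} → (∀ u → P u ≢ true) → count P ≡ 0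
count-none {zero} _ = refl
count-none {suc n} {P} never rewrite count-suc P | ¬-not (never zero) = count-none (λ u → never (suc u))

count-all : ∀ {n} {P : Fin n → Bool} → (∀ u → P u ≡ true) → count P ≡ n
count-all {zero} _ = refl
count-all {suc n} {P} P≡true rewrite count-suc P | P≡true zero = cong suc (count-all (λ u → P≡true (suc u)))

count-+ : ∀ {n} {P Q R T : Fin n → Bool} →
  (∀ u → ind (P u) + ind (Q u) ≡ ind (R u) + ind (T u)) →
  count P + count Q ≡ count R + count T
count-+ {zero} _ = refl
count-+ {suc n} {P} {Q} {R} {T} pointwise = begin
    count P + count Q
  ≡⟨ cong₂ _+_ (count-suc P) (count-suc Q) ⟩
    (ind (P zero) + count (P ∘suc)) + (ind (Q zero) + count (Q ∘suc))
  ≡⟨ interchange (ind (P zero)) _ _ _ ⟩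
    (ind (P zero) + ind (Q zero)) + (count (P ∘suc) + count (Q ∘suc))
  ≡⟨ cong₂ _+_ (pointwise zero) (count-+ (λ u → pointwise (suc u))) ⟩
    (ind (R zero) + ind (T zero)) + (count (R ∘suc) + count (T ∘suc))
  ≡⟨ interchange (ind (R zero)) _ _ _ ⟩
    (ind (R zero) + count (R ∘suc)) + (ind (T zero) + count (T ∘suc))
  ≡⟨ sym (cong₂ _+_ (count-suc R) (count-suc T)) ⟩
    count R + count T
  ∎
  where
    open ≡-Reasoning
    _∘suc : (Fin (suc n) → Bool) → Fin n → Bool
    (F ∘suc) u = F (suc u)

count-complement : ∀ {n} (P : Fin n → Bool) → count P + count (λ u → not (P u)) ≡ n
count-complement {n} P = begin
    count P + count (λ u → not (P u))
  ≡⟨ count-+ {R = λ _ → true} {T = λ _ → false} (λ u → ind-complement (P u)) ⟩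
    count {n} (λ _ → true) + count {n} (λ _ → false)
  ≡⟨ cong₂ _+_ (count-all {n} (λ _ → refl)) (count-none {n} (λ _ ())) ⟩
    n + 0
  ≡⟨ +-identityʳ n ⟩
    n
  ∎
  where
    open ≡-Reasoning
    ind-complement : ∀ b → ind b + ind (not b) ≡ 1
    ind-complement false = refl
    ind-complement true = refl

==-sound : ∀ {n} {x y : Fin n} → x == y ≡ true → x ≡ y
==-sound {x = x} {y} x==y with x ≟ y
... | yes x≡y = x≡y
==-sound () | no _

==-refl : ∀ {n} (x : Fin n) → x == x ≡ true
==-refl x with x ≟ x
... | yes _ = refl
... | no x≢x = contradiction refl x≢x

==-false : ∀ {n} {x y : Fin n} → x ≢ y → x == y ≡ false
==-false {x = x} {y} x≢y with x ≟ y
... | yes x≡y = contradiction x≡y x≢y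
... | no _ = refl

not==-sound : ∀ {n} {x y : Fin n} → not (x == y) ≡ true → x ≢ y
not==-sound {x = x} x≠x refl = case trans (sym x≠x) (cong not (==-refl x)) of λ ()

count-singleton : ∀ {n} (x : Fin n) → count (λ u → u == x) ≡ 1
count-singleton {suc n} zero = trans (count-suc {n} (λ u → u == zero)) (cong suc (count-none {n} (λ _ ())))
count-singleton {suc n} (suc x) = begin
    count (λ u → u == suc x)
  ≡⟨ count-suc (λ u → u == suc x) ⟩
    count (λ u → suc u == suc x)
  ≡⟨ count-cong (λ u → suc-== u x) ⟩
    count (λ u → u == x)
  ≡⟨ count-singleton x ⟩
    1
  ∎
  where
    open ≡-Reasoning
    suc-== : ∀ {n} (u x : Fin n) → (suc u == suc x) ≡ (u == x)
    suc-== u x with u ≟ x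
    ... | yes _ = refl
    ... | no _ = refl

-- Exactly two points lie in {x, y} when x ≢ y (inclusion–exclusion).
count-pair : ∀ {n} {x y : Fin n} → x ≢ y → count (λ u → u == x ∨ u == y) ≡ 2
count-pair {n} {x} {y} x≢y = begin
    count (λ u → u == x ∨ u == y)
  ≡⟨ sym (+-identityʳ _) ⟩
    count (λ u → u == x ∨ u == y) + 0
  ≡⟨ cong (count (λ u → u == x ∨ u == y) +_) (sym (count-none disjoint)) ⟩
    count (λ u → u == x ∨ u == y) + count (λ u → u == x ∧ u == y)
  ≡⟨ count-+ (λ u → ind-∨-∧ (u == x) (u == y)) ⟩
    count (λ u → u == x) + count (λ u → u == y)
  ≡⟨ cong₂ _+_ (count-singleton x) (count-singleton y) ⟩
    2
  ∎
  where
    open ≡-Reasoning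
    ind-∨-∧ : ∀ s t → ind (s ∨ t) + ind (s ∧ t) ≡ ind s + ind t
    ind-∨-∧ false t = +-identityʳ (ind t)
    ind-∨-∧ true false = refl
    ind-∨-∧ true true = refl
    disjoint : ∀ u → (u == x ∧ u == y) ≢ true
    disjoint u u∈x∩y = x≢y (trans (sym (==-sound {x = u} (∧-conicalˡ _ _ u∈x∩y)))
                                  (==-sound {x = u} (∧-conicalʳ (u == x) _ u∈x∩y)))

count-disjoint : ∀ {n} {P Z : Fin n → Bool} →
  (∀ u → P u ≡ true → Z u ≡ true → ⊥) → count Z + count P ≤ n
count-disjoint {n} {P} {Z} disjoint = begin
    count Z + count P
  ≤⟨ ℕ.+-monoˡ-≤ (count P) (count-mono Z⊆∁P) ⟩
    count (λ u → not (P u)) + count P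
  ≡⟨ +-comm (count (λ u → not (P u))) (count P) ⟩
    count P + count (λ u → not (P u))
  ≡⟨ count-complement P ⟩
    n
  ∎
  where
    open ℕ.≤-Reasoning
    Z⊆∁P : ∀ u → Z u ≡ true → not (P u) ≡ true
    Z⊆∁P u Zu with P u in Pu
    ... | true = ⊥-elim (disjoint u Pu Zu)
    ... | false = refl

count-cover : ∀ {n} {P Z : Fin n → Bool} →
  (∀ u → Z u ≡ false → P u ≡ true) → n ≤ count Z + count P
count-cover {n} {P} {Z} cover = begin
    n
  ≡⟨ sym (count-complement Z) ⟩
    count Z + count (λ u → not (Z u))
  ≤⟨ ℕ.+-monoʳ-≤ (count Z) (count-mono ∁Z⊆P) ⟩
    count Z + count P
  ∎
  where
    open ℕ.≤-Reasoning
    ∁Z⊆P : ∀ u → not (Z u) ≡ true → P u ≡ true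
    ∁Z⊆P u ∁Zu with Z u in Zu
    ... | false = cover u Zu

count-at-most-one : ∀ {n} {P : Fin n → Bool} (x : Fin n) → (∀ u → P u ≡ true → u ≡ x) → count P ≤ 1
count-at-most-one {P = P} x P⊆x = subst (count P ≤_) (count-singleton x)
  (count-mono (λ u Pu → subst (λ v → u == v ≡ true) (P⊆x u Pu) (==-refl u)))

count-miss-one : ∀ {n} {P : Fin (suc n) → Bool} (x : Fin (suc n)) →
  (∀ u → P u ≡ true → u ≢ x) → count P ≤ n
count-miss-one {n} {P} x miss = ℕ.+-cancelˡ-≤ 1 (count P) n
  (subst (λ c → c + count P ≤ suc n) (count-singleton x)
    (count-disjoint (λ u Pu u==x → miss u Pu (==-sound u==x))))

count-miss-two : ∀ {n} {P : Fin (suc (suc n)) → Bool} {x y : Fin (suc (suc n))} → x ≢ y →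
  (∀ u → P u ≡ true → u ≢ x × u ≢ y) → count P ≤ n
count-miss-two {n} {P} {x} {y} x≢y miss = ℕ.+-cancelˡ-≤ 2 (count P) n
  (subst (λ c → c + count P ≤ suc (suc n)) (count-pair x≢y) (count-disjoint disjoint))
  where
    disjoint : ∀ u → P u ≡ true → (u == x ∨ u == y) ≡ true → ⊥
    disjoint u Pu u∈xy with u ≟ x
    ... | yes u≡x = proj₁ (miss u Pu) u≡x
    ... | no _ = proj₂ (miss u Pu) (==-sound u∈xy)

count-all-but-two : ∀ {n} {P : Fin (suc (suc n)) → Bool} {x y : Fin (suc (suc n))} → x ≢ y →
  (∀ u → u ≢ x → u ≢ y → P u ≡ true) → n ≤ count P
count-all-but-two {n} {P} {x} {y} x≢y cover = ℕ.+-cancelˡ-≤ 2 n (count P)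
  (subst (λ c → suc (suc n) ≤ c + count P) (count-pair x≢y) (count-cover outside-xy))
  where
    outside-xy : ∀ u → (u == x ∨ u == y) ≡ false → P u ≡ true
    outside-xy u u∉xy with u ≟ x | u ≟ y
    outside-xy u () | yes _ | _
    outside-xy u () | no _ | yes _
    ... | no u≢x | no u≢y = cover u u≢x u≢y

data Side (p : ℕ) : Fin (V p) → Set where
  inA : ∀ l → Side p (a p l)
  inB : ∀ r → Side p (b p r)

side : ∀ p v → Side p v
side p v with splitAt (suc p) v in eq
... | inj₁ l = subst (Side p) (Fin.splitAt⁻¹-↑ˡ eq) (inA l)
... | inj₂ r = subst (Side p) (Fin.splitAt⁻¹-↑ʳ eq) (inB r)

a-injective : ∀ p {l m} → a p l ≡ a p m → l ≡ m
a-injective p = Fin.↑ˡ-injective p _ _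

b-injective : ∀ p {l m} → b p l ≡ b p m → l ≡ m
b-injective p = Fin.↑ʳ-injective (suc p) _ _

a≢b : ∀ p {l r} → a p l ≢ b p r
a≢b p {l} {r} al≡br with trans (sym (Fin.splitAt-↑ˡ (suc p) l p))
                              (trans (cong (splitAt (suc p)) al≡br) (Fin.splitAt-↑ʳ (suc p) p r))
... | ()

H-AA : ∀ p l m → H p (a p l) (a p m) ≡ not (l == m)
H-AA p l m rewrite Fin.splitAt-↑ˡ (suc p) l p | Fin.splitAt-↑ˡ (suc p) m p = refl

H-BB : ∀ p k r → H p (b p k) (b p r) ≡ not (k == r)
H-BB p k r rewrite Fin.splitAt-↑ʳ (suc p) p k | Fin.splitAt-↑ʳ (suc p) p r = refl

H-AB : ∀ p l r → H p (a p l) (b p r) ≡ false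
H-AB p l r rewrite Fin.splitAt-↑ˡ (suc p) l p | Fin.splitAt-↑ʳ (suc p) p r = refl

H-BA : ∀ p r l → H p (b p r) (a p l) ≡ false
H-BA p r l rewrite Fin.splitAt-↑ʳ (suc p) p r | Fin.splitAt-↑ˡ (suc p) l p = refl

H-AA-edge : ∀ p {l m} → l ≢ m → H p (a p l) (a p m) ≡ true
H-AA-edge p {l} {m} l≢m = trans (H-AA p l m) (cong not (==-false l≢m))

colour : ∀ p → Fin (V p) → Fin (suc p)
colour p v with splitAt (suc p) v
... | inj₁ l = l
... | inj₂ r = Fin.inject₁ r

colour-a : ∀ p l → colour p (a p l) ≡ l
colour-a p l rewrite Fin.splitAt-↑ˡ (suc p) l p = refl

colour-b : ∀ p r → colour p (b p r) ≡ Fin.inject₁ r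
colour-b p r rewrite Fin.splitAt-↑ʳ (suc p) p r = refl

colour-proper : ∀ p u v → H p u v ≡ true → colour p u ≢ colour p v
colour-proper p u v uv with side p u | side p v
... | inA l | inA m = λ same → not==-sound (trans (sym (H-AA p l m)) uv)
                                  (trans (sym (colour-a p l)) (trans same (colour-a p m)))
... | inB k | inB r = λ same → not==-sound (trans (sym (H-BB p k r)) uv)
                                  (Fin.inject₁-injective (trans (sym (colour-b p k)) (trans same (colour-b p r))))
... | inA l | inB r = case trans (sym (H-AB p l r)) uv of λ ()
... | inB k | inA l = case trans (sym (H-BA p k l)) uv of λ ()

clique-bound : ∀ {n m} (G : Graph n) (f : Fin m → Fin n) →
  (∀ x y → x ≢ y → G (f x) (f y) ≡ true) → ∀ k → Colourable k G → m ≤ k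
clique-bound {m = m} G f clique k (c , proper) with m ℕ.≤? k
... | yes m≤k = m≤k
... | no m≰k with Fin.pigeonhole (ℕ.≰⇒> m≰k) (λ x → c (f x))
...   | x , y , x<y , same = contradiction same (proper (f x) (f y) (clique x y (Fin.<⇒≢ x<y)))

chromatic-H : ∀ p → IsChromaticNumber (H p) (suc p)
chromatic-H p = (colour p , colour-proper p) , clique-bound (H p) (a p) (λ _ _ → H-AA-edge p)

Pair : ∀ {A : Set} → A → A → A → A → Set
Pair u w x y = (x ≡ u × y ≡ w) ⊎ (x ≡ w × y ≡ u)

Pair-map : ∀ {A B : Set} (f : A → B) {u w x y} → Pair u w x y → Pair (f u) (f w) (f x) (f y)
Pair-map f (inj₁ (x≡u , y≡w)) = inj₁ (cong f x≡u , cong f y≡w)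
Pair-map f (inj₂ (x≡w , y≡u)) = inj₂ (cong f x≡w , cong f y≡u)

Pair-injective : ∀ {A B : Set} (f : A → B) → (∀ {s t} → f s ≡ f t → s ≡ t) →
  ∀ {u w x y} → Pair (f u) (f w) (f x) (f y) → Pair u w x y
Pair-injective f inj (inj₁ (x≡u , y≡w)) = inj₁ (inj x≡u , inj y≡w)
Pair-injective f inj (inj₂ (x≡w , y≡u)) = inj₂ (inj x≡w , inj y≡u)

cross-AA : ∀ p {u w l m} → ¬ Pair (a p u) (b p w) (a p l) (a p m)
cross-AA p (inj₁ (_ , am≡bw)) = a≢b p am≡bw
cross-AA p (inj₂ (al≡bw , _)) = a≢b p al≡bw

cross-BB : ∀ p {u w k r} → ¬ Pair (a p u) (b p w) (b p k) (b p r)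
cross-BB p (inj₁ (bk≡au , _)) = a≢b p (sym bk≡au)
cross-BB p (inj₂ (_ , br≡au)) = a≢b p (sym br≡au)

cross-BA : ∀ p {u w k l} → Pair (a p u) (b p w) (b p k) (a p l) → k ≡ w × l ≡ u
cross-BA p (inj₁ (bk≡au , _)) = ⊥-elim (a≢b p (sym bk≡au))
cross-BA p (inj₂ (bk≡bw , al≡au)) = b-injective p bk≡bw , a-injective p al≡au

B-pair-AA : ∀ p {u w l m} → ¬ Pair (b p u) (b p w) (a p l) (a p m)
B-pair-AA p (inj₁ (al≡bu , _)) = a≢b p al≡bu
B-pair-AA p (inj₂ (al≡bw , _)) = a≢b p al≡bw

isPair-sound : ∀ {n} {u w x y : Fin n} → isPair u w x y ≡ true → Pair u w x y
isPair-sound {u = u} {w} {x} {y} xy=uw with x == u ∧ y == w in same-order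
... | true = inj₁ (==-sound (∧-conicalˡ _ _ same-order) , ==-sound (∧-conicalʳ _ _ same-order))
... | false = inj₂ (==-sound (∧-conicalˡ _ _ xy=uw) , ==-sound (∧-conicalʳ _ _ xy=uw))

isPair-complete : ∀ {n} {u w x y : Fin n} → Pair u w x y → isPair u w x y ≡ true
isPair-complete {u = u} {w} (inj₁ (refl , refl)) rewrite ==-refl u | ==-refl w = refl
isPair-complete {u = u} {w} (inj₂ (refl , refl)) rewrite ==-refl u | ==-refl w = ∨-zeroʳ _

isPair-false⇒¬Pair : ∀ {n} {u w x y : Fin n} → isPair u w x y ≡ false → ¬ Pair u w x y
isPair-false⇒¬Pair not-uw uw = case trans (sym not-uw) (isPair-complete uw) of λ ()

¬Pair⇒isPair-false : ∀ {n} {u w x y : Fin n} → ¬ Pair u w x y → isPair u w x y ≡ false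
¬Pair⇒isPair-false {u = u} {w} {x} {y} not-uw with isPair u w x y in uw
... | true = contradiction (isPair-sound uw) not-uw
... | false = refl

edge-cases : ∀ h r s c d → (h ∧ not (r ∨ s)) ∨ c ∨ d ≡ true →
  (h ≡ true × r ≡ false × s ≡ false) ⊎ c ≡ true ⊎ d ≡ true
edge-cases h r s true d _ = inj₂ (inj₁ refl)
edge-cases h r s false true _ = inj₂ (inj₂ refl)
edge-cases true false false false false _ = inj₁ (refl , refl , refl)

module Hij-edges (p : ℕ) (i j : Fin p) where

  i′ j′ : Fin (suc p)
  i′ = Fin.inject₁ i
  j′ = Fin.inject₁ j

  Kept : Fin (V p) → Fin (V p) → Set
  Kept x y = H p x y ≡ true × ¬ Pair (a p i′) (a p j′) x y × ¬ Pair (b p i) (b p j) x y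

  Hij-edge : ∀ x y → Hij p i j x y ≡ true →
    Kept x y ⊎ Pair (a p i′) (b p j) x y ⊎ Pair (a p j′) (b p i) x y
  Hij-edge x y xy with edge-cases (H p x y) _ _ _ _ xy
  ... | inj₁ (h , r , s) = inj₁ (h , isPair-false⇒¬Pair r , isPair-false⇒¬Pair s)
  ... | inj₂ (inj₁ c) = inj₂ (inj₁ (isPair-sound c))
  ... | inj₂ (inj₂ d) = inj₂ (inj₂ (isPair-sound d))

  Hij-keep : ∀ x y → Kept x y → Hij p i j x y ≡ true
  Hij-keep x y (h , not-aa , not-bb)
    rewrite h | ¬Pair⇒isPair-false not-aa | ¬Pair⇒isPair-false not-bb = refl

  AA-edge : ∀ l m → Hij p i j (a p l) (a p m) ≡ true → l ≢ m × ¬ Pair i′ j′ l m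
  AA-edge l m lm with Hij-edge _ _ lm
  ... | inj₁ (h , not-aa , _) = not==-sound (trans (sym (H-AA p l m)) h) , λ P → not-aa (Pair-map (a p) P)
  ... | inj₂ (inj₁ cross) = ⊥-elim (cross-AA p cross)
  ... | inj₂ (inj₂ cross) = ⊥-elim (cross-AA p cross)

  BB-edge : ∀ k r → Hij p i j (b p k) (b p r) ≡ true → k ≢ r × ¬ Pair i j k r
  BB-edge k r kr with Hij-edge _ _ kr
  ... | inj₁ (h , _ , not-bb) = not==-sound (trans (sym (H-BB p k r)) h) , λ P → not-bb (Pair-map (b p) P)
  ... | inj₂ (inj₁ cross) = ⊥-elim (cross-BB p cross)
  ... | inj₂ (inj₂ cross) = ⊥-elim (cross-BB p cross)

  BA-edge : ∀ k l → Hij p i j (b p k) (a p l) ≡ true → (k ≡ j × l ≡ i′) ⊎ (k ≡ i × l ≡ j′)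
  BA-edge k l kl with Hij-edge _ _ kl
  ... | inj₁ (h , _) = case trans (sym h) (H-BA p k l) of λ ()
  ... | inj₂ (inj₁ cross) = inj₁ (cross-BA p cross)
  ... | inj₂ (inj₂ cross) = inj₂ (cross-BA p cross)

  AA-keep : ∀ {l m} → l ≢ m → ¬ Pair i′ j′ l m → Hij p i j (a p l) (a p m) ≡ true
  AA-keep l≢m not-ij = Hij-keep _ _
    (H-AA-edge p l≢m , (λ P → not-ij (Pair-injective (a p) (a-injective p) P)) , B-pair-AA p)

∧-intro : ∀ {s t} → s ≡ true → t ≡ true → s ∧ t ≡ true
∧-intro refl refl = refl

module Degeneracy (q : ℕ) (i j : Fin (suc (suc q))) (i≢j : i ≢ j) where

  p : ℕ
  p = suc (suc q)

  open Hij-edges p i j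

  G : Graph (V p)
  G = Hij p i j

  i′≢j′ : i′ ≢ j′
  i′≢j′ i′≡j′ = i≢j (Fin.inject₁-injective i′≡j′)

  degree-split : ∀ S v → degIn G S v ≡
    count (λ l → S (a p l) ∧ G v (a p l)) + count (λ r → S (b p r) ∧ G v (b p r))
  degree-split S v = count-split (suc p) (λ u → S u ∧ G v u)

  -- Each b_k has at most p − 1 neighbours: b_i sees a_j and B ∖ {b_i, b_j}, b_j
  -- symmetrically, and any other b_k sees only B ∖ {b_k}.
  B-degree : ∀ S k → degIn G S (b p k) ≤ suc q
  B-degree S k rewrite degree-split S (b p k) with k ≟ i | k ≟ j
  ... | yes refl | _ = +-mono-≤ (count-at-most-one j′ A-nbr) (count-miss-two i≢j B-nbr)
    where
      A-nbr : ∀ l → S (a p l) ∧ G (b p i) (a p l) ≡ true → l ≡ j′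
      A-nbr l adj with BA-edge i l (∧-conicalʳ _ _ adj)
      ... | inj₁ (i≡j , _) = ⊥-elim (i≢j i≡j)
      ... | inj₂ (_ , l≡j′) = l≡j′
      B-nbr : ∀ r → S (b p r) ∧ G (b p i) (b p r) ≡ true → r ≢ i × r ≢ j
      B-nbr r adj with BB-edge i r (∧-conicalʳ _ _ adj)
      ... | i≢r , not-ij = (λ r≡i → i≢r (sym r≡i)) , λ r≡j → not-ij (inj₁ (refl , r≡j))
  ... | no _ | yes refl = +-mono-≤ (count-at-most-one i′ A-nbr) (count-miss-two (λ j≡i → i≢j (sym j≡i)) B-nbr)
    where
      A-nbr : ∀ l → S (a p l) ∧ G (b p j) (a p l) ≡ true → l ≡ i′
      A-nbr l adj with BA-edge j l (∧-conicalʳ _ _ adj)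
      ... | inj₁ (_ , l≡i′) = l≡i′
      ... | inj₂ (j≡i , _) = ⊥-elim (i≢j (sym j≡i))
      B-nbr : ∀ r → S (b p r) ∧ G (b p j) (b p r) ≡ true → r ≢ j × r ≢ i
      B-nbr r adj with BB-edge j r (∧-conicalʳ _ _ adj)
      ... | j≢r , not-ij = (λ r≡j → j≢r (sym r≡j)) , λ r≡i → not-ij (inj₂ (refl , r≡i))
  ... | no k≢i | no k≢j = +-mono-≤ (ℕ.≤-reflexive (count-none no-A-nbr)) (count-miss-one k B-nbr)
    where
      no-A-nbr : ∀ l → S (a p l) ∧ G (b p k) (a p l) ≢ true
      no-A-nbr l adj with BA-edge k l (∧-conicalʳ _ _ adj)
      ... | inj₁ (k≡j , _) = k≢j k≡j
      ... | inj₂ (k≡i , _) = k≢i k≡i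
      B-nbr : ∀ r → S (b p r) ∧ G (b p k) (b p r) ≡ true → r ≢ k
      B-nbr r adj r≡k = proj₁ (BB-edge k r (∧-conicalʳ _ _ adj)) (sym r≡k)

  -- If S avoids B, then a_l ∈ S has degree ≤ p − 1 as soon as its neighbours in S
  -- also avoid some a_x ≠ a_l (it already avoids itself).
  A-degree : ∀ S → (∀ r → S (b p r) ≢ true) → ∀ l x → l ≢ x →
    (∀ m → S (a p m) ∧ G (a p l) (a p m) ≡ true → m ≢ x) → degIn G S (a p l) ≤ suc q
  A-degree S no-B l x l≢x avoids-x = begin
      degIn G S (a p l)
    ≡⟨ degree-split S (a p l) ⟩
      count (λ m → S (a p m) ∧ G (a p l) (a p m)) + count (λ r → S (b p r) ∧ G (a p l) (b p r))
    ≡⟨ cong (count (λ m → S (a p m) ∧ G (a p l) (a p m)) +_) (count-none B-empty) ⟩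
      count (λ m → S (a p m) ∧ G (a p l) (a p m)) + 0
    ≡⟨ +-identityʳ _ ⟩
      count (λ m → S (a p m) ∧ G (a p l) (a p m))
    ≤⟨ count-miss-two l≢x A-nbr ⟩
      suc q
    ∎
    where
      open ℕ.≤-Reasoning
      B-empty : ∀ r → S (b p r) ∧ G (a p l) (b p r) ≢ true
      B-empty r adj = no-B r (∧-conicalˡ _ _ adj)
      A-nbr : ∀ m → S (a p m) ∧ G (a p l) (a p m) ≡ true → m ≢ l × m ≢ x
      A-nbr m adj = (λ m≡l → proj₁ (AA-edge l m (∧-conicalʳ _ _ adj)) (sym m≡l)) , avoids-x m adj

  -- An induced subgraph inside A: a_i (if present) misses a_j, else any vertex
  -- of S misses the absent a_i.
  A-low-vertex : ∀ S → (∀ r → S (b p r) ≢ true) → Nonempty S →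
    Σ (Fin (V p)) λ v → (S v ≡ true) × (degIn G S v ≤ suc q)
  A-low-vertex S no-B (w , Sw) with S (a p i′) in Sai′
  ... | true = a p i′ , Sai′ , A-degree S no-B i′ j′ i′≢j′ avoids-j′
    where
      avoids-j′ : ∀ m → S (a p m) ∧ G (a p i′) (a p m) ≡ true → m ≢ j′
      avoids-j′ m adj m≡j′ = proj₂ (AA-edge i′ m (∧-conicalʳ _ _ adj)) (inj₁ (refl , m≡j′))
  ... | false with side p w
  ...   | inB r = ⊥-elim (no-B r Sw)
  ...   | inA l = a p l , Sw , A-degree S no-B l i′ (avoids-i′ l Sw) (λ m adj → avoids-i′ m (∧-conicalˡ _ _ adj))
    where
      avoids-i′ : ∀ m → S (a p m) ≡ true → m ≢ i′
      avoids-i′ m Sam refl = case trans (sym Sam) Sai′ of λ ()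

  upper : Degenerate (suc q) G
  upper S S≠∅ with Fin.any? (λ r → S (b p r) Bool.≟ true)
  ... | yes (k , Sbk) = b p k , Sbk , B-degree S k
  ... | no S∩B=∅ = A-low-vertex S (λ r Sbr → S∩B=∅ (r , Sbr)) S≠∅

  -- The witness set: the H-neighbourhood of a_i, i.e. A ∖ {a_i}.
  S₀ : VSet (V p)
  S₀ = H p (a p i′)

  S₀-degree : ∀ l → i′ ≢ l → suc q ≤ degIn G S₀ (a p l)
  S₀-degree l i′≢l = begin
      suc q
    ≤⟨ count-all-but-two (λ l≡i′ → i′≢l (sym l≡i′)) A-nbr ⟩
      count (λ m → S₀ (a p m) ∧ G (a p l) (a p m))
    ≤⟨ ℕ.m≤m+n _ _ ⟩
      count (λ m → S₀ (a p m) ∧ G (a p l) (a p m)) + count (λ r → S₀ (b p r) ∧ G (a p l) (b p r))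
    ≡⟨ sym (degree-split S₀ (a p l)) ⟩
      degIn G S₀ (a p l)
    ∎
    where
      open ℕ.≤-Reasoning
      A-nbr : ∀ m → m ≢ l → m ≢ i′ → S₀ (a p m) ∧ G (a p l) (a p m) ≡ true
      A-nbr m m≢l m≢i′ = ∧-intro (H-AA-edge p (λ i′≡m → m≢i′ (sym i′≡m)))
        (AA-keep (λ l≡m → m≢l (sym l≡m)) λ { (inj₁ (l≡i′ , _)) → i′≢l (sym l≡i′)
                                             ; (inj₂ (_ , m≡i′)) → m≢i′ m≡i′ })

  lower : ∀ k → Degenerate k G → suc q ≤ k
  lower k degenerate with degenerate S₀ (a p j′ , H-AA-edge p i′≢j′)
  ... | v , S₀v , deg≤k with side p v
  ...   | inA l = ℕ.≤-trans (S₀-degree l (not==-sound (trans (sym (H-AA p i′ l)) S₀v))) deg≤k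
  ...   | inB r = case trans (sym S₀v) (H-AB p i′ r) of λ ()

-- κ(H_ij) = p − 1 for i < j (which forces p ≥ 2).
degeneracy-Hij : ∀ p (i j : Fin p) → i < j → IsDegeneracy (Hij p i j) (p ∸ 1)
degeneracy-Hij (suc (suc q)) i j i<j = upper , lower
  where open Degeneracy q i j (Fin.<⇒≢ i<j)
degeneracy-Hij (suc zero) zero zero ()

lemma5p10 : (p : ℕ) →
    ((i j : Fin p) → i < j → IsDegeneracy (Hij p i j) (p ∸ 1))
    × IsChromaticNumber (H p) (suc p)
lemma5p10 p = degeneracy-Hij p , chromatic-H p
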